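{- Let $G$ be an Eulerian digraph with $n$ vertices and $m$ arcs. Then $\beta(G) \ge \frac{m^2}{2n^2} + \frac{m}{2n}$.
   Context: All digraphs are finite and simple: no loops and no multiple arcs, but two arcs in opposite directions $(u,v)$ and $(v,u)$ between the same pair of vertices are allowed. A digraph is Eulerian if every vertex has in-degree equal to its out-degree. A feedback arc set of a digraph is a set of arcs whose removal leaves a digraph with no directed cycle; $\beta(G)$ denotes the minimum size of a feedback arc set of $G$. -}

module Defs where

open import Data.Nat using (ℕ; zero; suc; _+_; _*_; _≤_)
open import Data.Bool using (Bool; true; false; if_then_else_; _∧_; not; T)
open import Data.Fin using (Fin; zero; suc; inject₁; fromℕ)
open import Data.List using (List; map; allFin)
open import Data.Nat.ListAction using (sum)
open import Data.Product using (Σ; _×_)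
open import Function.Definitions using (Injective)
open import Relation.Binary.PropositionalEquality using (_≡_)
open import Relation.Nullary using (¬_)

-- A digraph on vertex set Fin n, given by its (decidable) arc relation.
-- Opposite arcs (u,v),(v,u) are allowed; multiple arcs cannot be expressed; loops are excluded.
record Digraph (n : ℕ) : Set where
  field
    arc    : Fin n → Fin n → Bool
    noLoop : ∀ v → arc v v ≡ false
open Digraph public

count : ∀ {n} → (Fin n → Bool) → ℕ
count {n} p = sum (map (λ i → if p i then 1 else 0) (allFin n))

count₂ : ∀ {n} → (Fin n → Fin n → Bool) → ℕ
count₂ {n} r = sum (map (λ u → count (r u)) (allFin n))

numArcs : ∀ {n} → Digraph n → ℕ
numArcs G = count₂ (arc G)

outDeg inDeg : ∀ {n} → Digraph n → Fin n → ℕ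
outDeg G v = count (λ w → arc G v w)
inDeg  G v = count (λ u → arc G u v)

Eulerian : ∀ {n} → Digraph n → Set
Eulerian G = ∀ v → inDeg G v ≡ outDeg G v

record DirectedCycle {n : ℕ} (E : Fin n → Fin n → Bool) : Set where
  field
    k       : ℕ
    c       : Fin (suc k) → Fin n
    distinct : Injective _≡_ _≡_ c
    step    : ∀ (i : Fin k) → T (E (c (inject₁ i)) (c (suc i)))
    close   : T (E (c (fromℕ k)) (c zero))

Acyclic : ∀ {n} → (Fin n → Fin n → Bool) → Set
Acyclic E = ¬ DirectedCycle E

-- A set F of arcs of G (as a boolean relation contained in the arc relation).
-- G − F has arc relation  arc G u v ∧ not (F u v).
IsFeedbackArcSet : ∀ {n} → Digraph n → (Fin n → Fin n → Bool) → Set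
IsFeedbackArcSet G F =
  (∀ u v → T (F u v) → T (arc G u v)) ×
  Acyclic (λ u v → arc G u v ∧ not (F u v))

module Submission where

-- Since G − F is acyclic, a topological sort gives a ranking of the vertices in which
-- every arc pointing to a lower rank ("backward arc") lies in F.  Rotating the ranks
-- cyclically (r ↦ r + t mod n) does not change the number B of backward arcs: the arcs
-- that start being backward are those entering the set of vertices whose rank wraps
-- around, those that stop being backward leave it, and in an Eulerian digraph every
-- vertex set is entered and left equally often.  In any ranking a vertex v of rank p
-- has at most p in-arcs from below, so at least indeg(v) − p of its in-arcs are
-- backward.  Over the n rotations v takes every rank 0, …, n−1 once, whence
-- n·B ≥ ∑ᵥ ∑ₖ (dᵥ − k) ≥ ∑ᵥ dᵥ(dᵥ+1)/2 with dᵥ = indeg(v).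
-- Cauchy–Schwarz, m² ≤ n ∑ dᵥ², finishes the proof.

open import Defs
open import Data.Nat using (ℕ; _+_; _*_; _≤_)
open import Data.Bool using (Bool)
open import Data.Fin using (Fin)

open import Data.Nat using (zero; suc; _∸_; _<_; _<ᵇ_; _≡ᵇ_; z≤n; s≤s; s≤s⁻¹)
open import Data.Nat.Properties hiding (_≟_)
open import Data.Nat.Solver using (module +-*-Solver)
import Data.Nat.ListAction as List
open import Data.Bool using (true; false; if_then_else_; _∧_; not; T)
open import Data.Fin using (zero; suc; toℕ; fromℕ<; punchIn; punchOut; _≟_)
open import Data.Fin.Properties using (toℕ<n; toℕ-injective; toℕ-inject₁; toℕ-fromℕ; toℕ-fromℕ<;
  injective⇒≤; punchIn-injective; punchOut-injective; punchIn-punchOut; any?; all?; ¬∀⟶∃¬)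
import Data.Fin.Properties as Fin
open import Data.List using (map; allFin; tabulate)
open import Data.List.Properties using (map-tabulate)
open import Data.Product using (Σ; ∃-syntax; _,_; proj₁; proj₂)
open import Data.Sum using (inj₁; inj₂)
open import Function using (_∘_; id)
open import Function.Definitions using (Injective)
open import Relation.Nullary using (¬_; yes; no; contradiction)
open import Relation.Nullary.Decidable using (T?; ¬?; decidable-stable)
open import Relation.Nullary.Reflects using (Reflects; ofʸ; ofⁿ; fromEquivalence; det)
open import Relation.Binary.PropositionalEquality
open import Algebra.Properties.Semiring.Sum +-*-semiring
  using (sum-syntax; sum-cong-≗; ∑-distrib-+; ∑-comm; *-distribˡ-sum)

𝟙 : Bool → ℕ
𝟙 b = if b then 1 else 0

𝟙≤1 : ∀ b → 𝟙 b ≤ 1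
𝟙≤1 true  = ≤-refl
𝟙≤1 false = z≤n

list-sum≡∑ : ∀ {n} (f : Fin n → ℕ) → List.sum (map f (allFin n)) ≡ ∑[ i < n ] f i
list-sum≡∑ {n} f = trans (cong List.sum (map-tabulate id f)) (sum-tabulate f)
  where
  sum-tabulate : ∀ {k} (g : Fin k → ℕ) → List.sum (tabulate g) ≡ ∑[ i < k ] g i
  sum-tabulate {zero}  g = refl
  sum-tabulate {suc k} g = cong (g zero +_) (sum-tabulate (g ∘ suc))

count≡∑ : ∀ {n} (p : Fin n → Bool) → count p ≡ ∑[ i < n ] 𝟙 (p i)
count≡∑ p = list-sum≡∑ (λ i → 𝟙 (p i))

count₂≡∑ : ∀ {n} (r : Fin n → Fin n → Bool) → count₂ r ≡ ∑[ u < n ] ∑[ v < n ] 𝟙 (r u v)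
count₂≡∑ r = trans (list-sum≡∑ (λ u → count (r u))) (sum-cong-≗ (λ u → count≡∑ (r u)))

∑-mono-≤ : ∀ {n} {f g : Fin n → ℕ} → (∀ i → f i ≤ g i) → ∑[ i < n ] f i ≤ ∑[ i < n ] g i
∑-mono-≤ {zero}  f≤g = z≤n
∑-mono-≤ {suc n} f≤g = +-mono-≤ (f≤g zero) (∑-mono-≤ (f≤g ∘ suc))

∑-const : ∀ n c → ∑[ i < n ] c ≡ n * c
∑-const zero    c = refl
∑-const (suc n) c = cong (c +_) (∑-const n c)

∑-bounded : ∀ {n} {f : Fin n → ℕ} c → (∀ i → f i ≤ c) → ∑[ i < n ] f i ≤ n * c
∑-bounded {n} c f≤c = ≤-trans (∑-mono-≤ f≤c) (≤-reflexive (∑-const n c))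

-- 2xy ≤ x² + y², the two-variable case of Cauchy–Schwarz; for x ≤ y = x + d it
-- is the identity x² + y² = 2xy + d².
2xy≤x²+y²-ordered : ∀ {x y} → x ≤ y → 2 * (x * y) ≤ x * x + y * y
2xy≤x²+y²-ordered {x} x≤y with m≤n⇒∃[o]m+o≡n x≤y
... | d , refl = ≤-trans (m≤m+n _ (d * d)) (≤-reflexive (solve 2
      (λ x d → con 2 :* (x :* (x :+ d)) :+ d :* d := x :* x :+ (x :+ d) :* (x :+ d)) refl x d))
  where open +-*-Solver

2xy≤x²+y² : ∀ x y → 2 * (x * y) ≤ x * x + y * y
2xy≤x²+y² x y with ≤-total x y
... | inj₁ x≤y = 2xy≤x²+y²-ordered x≤y
... | inj₂ y≤x = subst₂ _≤_ (cong (2 *_) (*-comm y x)) (+-comm (y * y) (x * x)) (2xy≤x²+y²-ordered y≤x)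

cauchy-schwarz : ∀ n (f : Fin n → ℕ) → ∑[ i < n ] f i * ∑[ i < n ] f i ≤ n * ∑[ i < n ] (f i * f i)
cauchy-schwarz zero    f = z≤n
cauchy-schwarz (suc n) f = begin
  (x + s) * (x + s)               ≡⟨ expand ⟩
  x * x + 2 * (x * s) + s * s     ≤⟨ +-mono-≤ (+-monoʳ-≤ (x * x) cross-terms) (cauchy-schwarz n (f ∘ suc)) ⟩
  x * x + (n * (x * x) + q) + n * q ≡⟨ collect ⟩
  suc n * (x * x + q)             ∎
  where
  open ≤-Reasoning
  open +-*-Solver
  x = f zero
  s = ∑[ i < n ] f (suc i)
  q = ∑[ i < n ] (f (suc i) * f (suc i))
  cross-terms : 2 * (x * s) ≤ n * (x * x) + q
  cross-terms = begin
    2 * (x * s)                              ≡⟨ cong (2 *_) (*-distribˡ-sum x (f ∘ suc)) ⟩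
    2 * ∑[ i < n ] (x * f (suc i))           ≡⟨ *-distribˡ-sum 2 (λ i → x * f (suc i)) ⟩
    ∑[ i < n ] (2 * (x * f (suc i)))         ≤⟨ ∑-mono-≤ (λ i → 2xy≤x²+y² x (f (suc i))) ⟩
    ∑[ i < n ] (x * x + f (suc i) * f (suc i)) ≡⟨ ∑-distrib-+ (λ _ → x * x) (λ i → f (suc i) * f (suc i)) ⟩
    ∑[ i < n ] (x * x) + q                   ≡⟨ cong (_+ q) (∑-const n (x * x)) ⟩
    n * (x * x) + q                          ∎
  expand : (x + s) * (x + s) ≡ x * x + 2 * (x * s) + s * s
  expand = solve 2 (λ x s → (x :+ s) :* (x :+ s) := x :* x :+ con 2 :* (x :* s) :+ s :* s) refl x s
  collect : x * x + (n * (x * x) + q) + n * q ≡ suc n * (x * x + q)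
  collect = solve 3 (λ x n q → x :* x :+ (n :* (x :* x) :+ q) :+ n :* q := (con 1 :+ n) :* (x :* x :+ q)) refl x n q

Σ< : ℕ → (ℕ → ℕ) → ℕ
Σ< k f = ∑[ i < k ] f (toℕ i)

Σ<-split : ∀ a b (f : ℕ → ℕ) → Σ< (a + b) f ≡ Σ< a f + Σ< b (λ s → f (a + s))
Σ<-split zero    b f = refl
Σ<-split (suc a) b f = trans (cong (f 0 +_) (Σ<-split a b (f ∘ suc))) (sym (+-assoc (f 0) _ _))

Σ<-cong : ∀ k {f g : ℕ → ℕ} → (∀ t → t < k → f t ≡ g t) → Σ< k f ≡ Σ< k g
Σ<-cong k f≡g = sum-cong-≗ (λ i → f≡g (toℕ i) (toℕ<n i))

triangle : ∀ d → 2 * Σ< d (d ∸_) ≡ d * suc d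
triangle zero    = refl
triangle (suc d) = begin
  2 * (suc d + Σ< d (d ∸_))       ≡⟨ *-distribˡ-+ 2 (suc d) _ ⟩
  2 * suc d + 2 * Σ< d (d ∸_)     ≡⟨ cong (2 * suc d +_) (triangle d) ⟩
  2 * suc d + d * suc d           ≡⟨ solve 1 (λ d → con 2 :* (con 1 :+ d) :+ d :* (con 1 :+ d)
                                                   := (con 1 :+ d) :* (con 2 :+ d)) refl d ⟩
  suc d * suc (suc d)             ∎
  where
  open ≡-Reasoning
  open +-*-Solver

-- The terms d - k vanish for k ≥ d, so summing over a longer range changes nothing.
triangle-≤ : ∀ {d n} → d ≤ n → d * suc d ≤ 2 * Σ< n (d ∸_)
triangle-≤ {d} d≤n with m≤n⇒∃[o]m+o≡n d≤n
... | e , refl = begin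
  d * suc d                                    ≡⟨ triangle d ⟨
  2 * Σ< d (d ∸_)                              ≤⟨ *-monoʳ-≤ 2 (m≤m+n (Σ< d (d ∸_)) _) ⟩
  2 * (Σ< d (d ∸_) + Σ< e (λ s → d ∸ (d + s))) ≡⟨ cong (2 *_) (Σ<-split d e (d ∸_)) ⟨
  2 * Σ< (d + e) (d ∸_)                        ∎
  where open ≤-Reasoning

<ᵇ-true : ∀ {m n} → m < n → (m <ᵇ n) ≡ true
<ᵇ-true {m} {n} m<n = det (<ᵇ-reflects-< m n) (ofʸ m<n)

<ᵇ-false : ∀ {m n} → ¬ m < n → (m <ᵇ n) ≡ false
<ᵇ-false {m} {n} m≮n = det (<ᵇ-reflects-< m n) (ofⁿ m≮n)

<ᵇ-cong : ∀ {m n k l} → (m < n → k < l) → (k < l → m < n) → (m <ᵇ n) ≡ (k <ᵇ l)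
<ᵇ-cong {m} {n} {k} {l} to from with k <ᵇ l | <ᵇ-reflects-< k l
... | true  | ofʸ k<l = <ᵇ-true (from k<l)
... | false | ofⁿ k≮l = <ᵇ-false (k≮l ∘ to)

≡ᵇ-reflects-≡ : ∀ m n → Reflects (m ≡ n) (m ≡ᵇ n)
≡ᵇ-reflects-≡ m n = fromEquivalence (≡ᵇ⇒≡ m n) (≡⇒≡ᵇ m n)

≡ᵇ-true : ∀ {m n} → m ≡ n → (m ≡ᵇ n) ≡ true
≡ᵇ-true {m} {n} m≡n = det (≡ᵇ-reflects-≡ m n) (ofʸ m≡n)

rotate : ℕ → ℕ → ℕ → ℕ
rotate n t r = if r + t <ᵇ n then r + t else r + t ∸ n

rotate-unwrapped : ∀ {n t r} → r + t < n → rotate n t r ≡ r + t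
rotate-unwrapped r+t<n rewrite <ᵇ-true r+t<n = refl

rotate-wrapped : ∀ {n t r} → n ≤ r + t → rotate n t r ≡ r + t ∸ n
rotate-wrapped n≤r+t rewrite <ᵇ-false (≤⇒≯ n≤r+t) = refl

-- A wrapped rank lands below t, hence below every unwrapped rank.
wrapped<unwrapped : ∀ {n t r s} → n ≤ s + t → s < n → s + t ∸ n < r + t
wrapped<unwrapped {n} {t} {r} {s} n≤s+t s<n = begin-strict
  s + t ∸ n   <⟨ ∸-monoˡ-< (+-monoˡ-< t s<n) n≤s+t ⟩
  n + t ∸ n   ≡⟨ m+n∸m≡n n t ⟩
  t           ≤⟨ m≤n+m t r ⟩
  r + t       ∎
  where open ≤-Reasoning

rotate-< : ∀ {n t r} → t ≤ n → r < n → rotate n t r < n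
rotate-< {n} {t} {r} t≤n r<n with r + t <ᵇ n | <ᵇ-reflects-< (r + t) n
... | true  | ofʸ r+t<n = r+t<n
... | false | ofⁿ _     = begin-strict
  r + t ∸ n   ≤⟨ ∸-monoˡ-≤ n (+-monoʳ-≤ r t≤n) ⟩
  r + n ∸ n   ≡⟨ m+n∸n≡m r n ⟩
  r           <⟨ r<n ⟩
  n           ∎
  where open ≤-Reasoning

rotate-injective : ∀ {n t r s} → r < n → s < n → rotate n t r ≡ rotate n t s → r ≡ s
rotate-injective {n} {t} {r} {s} r<n s<n eq
  with r + t <ᵇ n | <ᵇ-reflects-< (r + t) n | s + t <ᵇ n | <ᵇ-reflects-< (s + t) n
... | true  | ofʸ _   | true  | ofʸ _   = +-cancelʳ-≡ t r s eq
... | true  | ofʸ _   | false | ofⁿ s≮ = contradiction (sym eq) (<⇒≢ (wrapped<unwrapped (≮⇒≥ s≮) s<n))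
... | false | ofⁿ r≮ | true  | ofʸ _   = contradiction eq (<⇒≢ (wrapped<unwrapped (≮⇒≥ r≮) r<n))
... | false | ofⁿ r≮ | false | ofⁿ s≮ = +-cancelʳ-≡ t r s (begin
  r + t           ≡⟨ m∸n+n≡m (≮⇒≥ r≮) ⟨
  r + t ∸ n + n   ≡⟨ cong (_+ n) eq ⟩
  s + t ∸ n + n   ≡⟨ m∸n+n≡m (≮⇒≥ s≮) ⟩
  s + t           ∎)
  where open ≡-Reasoning

-- In indicator form: the pair of ranks (r, s) is inverted by the rotation (s below r
-- afterwards) exactly when it was inverted before, except for pairs where exactly one
-- rank wraps: if s wraps and r does not, the pair becomes inverted; if r wraps and s
-- does not, it stops being inverted.
rotate-order : ∀ {n t r s} → r < n → s < n →
  𝟙 (rotate n t s <ᵇ rotate n t r) + 𝟙 (not (r + t <ᵇ n) ∧ (s + t <ᵇ n))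
    ≡ 𝟙 (s <ᵇ r) + 𝟙 ((r + t <ᵇ n) ∧ not (s + t <ᵇ n))
rotate-order {n} {t} {r} {s} r<n s<n
  with r + t <ᵇ n | <ᵇ-reflects-< (r + t) n | s + t <ᵇ n | <ᵇ-reflects-< (s + t) n
... | true  | ofʸ _     | true  | ofʸ _     =
  cong (λ b → 𝟙 b + 0) (<ᵇ-cong (+-cancelʳ-< t s r) (+-monoˡ-< t))
... | true  | ofʸ r+t<n | false | ofⁿ s≮
  rewrite <ᵇ-true (wrapped<unwrapped {r = r} (≮⇒≥ s≮) s<n)
        | <ᵇ-false (λ s<r → s≮ (≤-<-trans (+-monoˡ-≤ t (<⇒≤ s<r)) r+t<n)) = refl
... | false | ofⁿ r≮     | true  | ofʸ s+t<n
  rewrite <ᵇ-false (<⇒≯ (wrapped<unwrapped {r = s} (≮⇒≥ r≮) r<n))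
        | <ᵇ-true (+-cancelʳ-< t s r (<-≤-trans s+t<n (≮⇒≥ r≮))) = refl
... | false | ofⁿ r≮     | false | ofⁿ s≮     =
  cong (λ b → 𝟙 b + 0) (<ᵇ-cong (λ lt → +-cancelʳ-< t s r (≰⇒> (λ r+t≤s+t → <⇒≱ lt (∸-monoˡ-≤ n r+t≤s+t))))
                                (λ s<r → ∸-monoˡ-< (+-monoˡ-< t s<r) (≮⇒≥ s≮)))

-- For a fixed rank r < n, as t runs through 0, …, n-1 the rotated rank of r runs
-- through 0, …, n-1 exactly once: first r, …, n-1, then 0, …, r-1.
rotation-sum : ∀ {n r} → r < n → (f : ℕ → ℕ) → Σ< n (λ t → f (rotate n t r)) ≡ Σ< n f
rotation-sum {n} {r} r<n f = begin
  Σ< n g                                  ≡⟨ cong (λ k → Σ< k g) (m∸n+n≡m (<⇒≤ r<n)) ⟨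
  Σ< (b + r) g                            ≡⟨ Σ<-split b r g ⟩
  Σ< b g + Σ< r (λ s → g (b + s))         ≡⟨ cong₂ _+_ (Σ<-cong b unwrapped) (Σ<-cong r wrapped) ⟩
  Σ< b (λ t → f (r + t)) + Σ< r f         ≡⟨ +-comm (Σ< b (λ t → f (r + t))) (Σ< r f) ⟩
  Σ< r f + Σ< b (λ t → f (r + t))         ≡⟨ Σ<-split r b f ⟨
  Σ< (r + b) f                            ≡⟨ cong (λ k → Σ< k f) (m+[n∸m]≡n (<⇒≤ r<n)) ⟩
  Σ< n f                                  ∎
  where
  open ≡-Reasoning
  g : ℕ → ℕ
  g t = f (rotate n t r)
  b = n ∸ r
  unwrapped : ∀ t → t < b → g t ≡ f (r + t)
  unwrapped t t<b = cong f (rotate-unwrapped {t = t} {r = r} (subst (r + t <_) (m+[n∸m]≡n (<⇒≤ r<n)) (+-monoʳ-< r t<b)))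
  r+b+s≡n+s : ∀ s → r + (b + s) ≡ n + s
  r+b+s≡n+s s = trans (sym (+-assoc r b s)) (cong (_+ s) (m+[n∸m]≡n (<⇒≤ r<n)))
  wrapped : ∀ s → s < r → g (b + s) ≡ f s
  wrapped s _ = cong f (begin
    rotate n (b + s) r   ≡⟨ rotate-wrapped {t = b + s} {r = r} (subst (n ≤_) (sym (r+b+s≡n+s s)) (m≤m+n n s)) ⟩
    r + (b + s) ∸ n      ≡⟨ cong (_∸ n) (r+b+s≡n+s s) ⟩
    n + s ∸ n            ≡⟨ m+n∸m≡n n s ⟩
    s                    ∎)

count-value : ∀ {n} (f : Fin n → ℕ) → Injective _≡_ _≡_ f → ∀ c → ∑[ v < n ] 𝟙 (f v ≡ᵇ c) ≤ 1
count-value {zero}  f inj c = z≤n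
count-value {suc n} f inj c with f zero ≡ᵇ c | ≡ᵇ-reflects-≡ (f zero) c
... | false | ofⁿ _     = count-value (f ∘ suc) (Fin.suc-injective ∘ inj) c
... | true  | ofʸ f0≡c = s≤s (≤-trans (∑-bounded 0 others-differ) (≤-reflexive (*-zeroʳ n)))
  where
  others-differ : ∀ v → 𝟙 (f (suc v) ≡ᵇ c) ≤ 0
  others-differ v with f (suc v) ≡ᵇ c | ≡ᵇ-reflects-≡ (f (suc v)) c
  ... | false | _           = z≤n
  ... | true  | ofʸ fv≡c = contradiction (inj (trans fv≡c (sym f0≡c))) λ ()

count-below : ∀ {n} (f : Fin n → ℕ) → Injective _≡_ _≡_ f → ∀ p → ∑[ v < n ] 𝟙 (f v <ᵇ p) ≤ p
count-below {n} f inj zero    = ≤-trans (∑-bounded {f = λ v → 𝟙 (f v <ᵇ 0)} 0 (λ _ → z≤n)) (≤-reflexive (*-zeroʳ n))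
count-below {n} f inj (suc p) = begin
  ∑[ v < n ] 𝟙 (f v <ᵇ suc p)                          ≤⟨ ∑-mono-≤ below-or-at ⟩
  ∑[ v < n ] (𝟙 (f v <ᵇ p) + 𝟙 (f v ≡ᵇ p))             ≡⟨ ∑-distrib-+ (λ v → 𝟙 (f v <ᵇ p)) (λ v → 𝟙 (f v ≡ᵇ p)) ⟩
  ∑[ v < n ] 𝟙 (f v <ᵇ p) + ∑[ v < n ] 𝟙 (f v ≡ᵇ p)   ≤⟨ +-mono-≤ (count-below f inj p) (count-value f inj p) ⟩
  p + 1                                                ≡⟨ +-comm p 1 ⟩
  suc p                                                ∎
  where
  open ≤-Reasoning
  below-or-at : ∀ v → 𝟙 (f v <ᵇ suc p) ≤ 𝟙 (f v <ᵇ p) + 𝟙 (f v ≡ᵇ p)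
  below-or-at v with f v <ᵇ suc p | <ᵇ-reflects-< (f v) (suc p) | f v <ᵇ p | <ᵇ-reflects-< (f v) p
  ... | false | _          | _     | _         = z≤n
  ... | true  | _          | true  | _         = s≤s z≤n
  ... | true  | ofʸ fv<1+p | false | ofⁿ fv≮p
    rewrite ≡ᵇ-true (≤-antisym (s≤s⁻¹ fv<1+p) (≮⇒≥ fv≮p)) = ≤-refl

Arcs : ℕ → Set
Arcs n = Fin n → Fin n → Bool

indeg outdeg : ∀ {n} → Arcs n → Fin n → ℕ
indeg  {n} A v = ∑[ u < n ] 𝟙 (A u v)
outdeg {n} A u = ∑[ v < n ] 𝟙 (A u v)

Balanced Loopless : ∀ {n} → Arcs n → Set
Balanced A = ∀ v → indeg A v ≡ outdeg A v
Loopless A = ∀ v → A v v ≡ false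

∑₂ : ∀ {n} → (Fin n → Fin n → ℕ) → ℕ
∑₂ {n} h = ∑[ u < n ] ∑[ v < n ] h u v

∑₂-cong : ∀ {n} {g h : Fin n → Fin n → ℕ} → (∀ u v → g u v ≡ h u v) → ∑₂ g ≡ ∑₂ h
∑₂-cong g≡h = sum-cong-≗ (λ u → sum-cong-≗ (g≡h u))

∑₂-distrib-+ : ∀ {n} (g h : Fin n → Fin n → ℕ) → ∑₂ (λ u v → g u v + h u v) ≡ ∑₂ g + ∑₂ h
∑₂-distrib-+ {n} g h = trans (sum-cong-≗ (λ u → ∑-distrib-+ (g u) (h u)))
                             (∑-distrib-+ (λ u → ∑[ v < n ] g u v) (λ u → ∑[ v < n ] h u v))

split-at-tail : ∀ a x y → 𝟙 x * 𝟙 a ≡ 𝟙 (a ∧ (x ∧ y)) + 𝟙 (a ∧ (x ∧ not y))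
split-at-tail true  true  true  = refl
split-at-tail true  true  false = refl
split-at-tail true  false y     = refl
split-at-tail false true  true  = refl
split-at-tail false true  false = refl
split-at-tail false false y     = refl

split-at-head : ∀ a x y → 𝟙 y * 𝟙 a ≡ 𝟙 (a ∧ (x ∧ y)) + 𝟙 (a ∧ (not x ∧ y))
split-at-head true  true  true  = refl
split-at-head true  true  false = refl
split-at-head true  false true  = refl
split-at-head true  false false = refl
split-at-head false true  true  = refl
split-at-head false true  false = refl
split-at-head false false true  = refl
split-at-head false false false = refl

-- In a balanced relation every vertex set U is left by as many arcs as enter it:
-- both counts are ∑_{v ∈ U} deg v minus the number of arcs inside U.
balanced-cut : ∀ {n} {A : Arcs n} → Balanced A → (U : Fin n → Bool) →
  ∑₂ (λ u v → 𝟙 (A u v ∧ (U u ∧ not (U v)))) ≡ ∑₂ (λ u v → 𝟙 (A u v ∧ (not (U u) ∧ U v)))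
balanced-cut {n} {A} balanced U = +-cancelˡ-≡ (∑₂ inside) (∑₂ leaving) (∑₂ entering) (begin
  ∑₂ inside + ∑₂ leaving                        ≡⟨ ∑₂-distrib-+ inside leaving ⟨
  ∑₂ (λ u v → inside u v + leaving u v)         ≡⟨ ∑₂-cong (λ u v → split-at-tail (A u v) (U u) (U v)) ⟨
  ∑₂ (λ u v → 𝟙 (U u) * 𝟙 (A u v))              ≡⟨ sum-cong-≗ (λ u → *-distribˡ-sum (𝟙 (U u)) (λ v → 𝟙 (A u v))) ⟨
  ∑[ u < n ] (𝟙 (U u) * outdeg A u)             ≡⟨ sum-cong-≗ (λ u → cong (𝟙 (U u) *_) (balanced u)) ⟨
  ∑[ v < n ] (𝟙 (U v) * indeg A v)              ≡⟨ sum-cong-≗ (λ v → *-distribˡ-sum (𝟙 (U v)) (λ u → 𝟙 (A u v))) ⟩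
  ∑[ v < n ] ∑[ u < n ] (𝟙 (U v) * 𝟙 (A u v))   ≡⟨ ∑-comm (λ v u → 𝟙 (U v) * 𝟙 (A u v)) ⟩
  ∑₂ (λ u v → 𝟙 (U v) * 𝟙 (A u v))              ≡⟨ ∑₂-cong (λ u v → split-at-head (A u v) (U u) (U v)) ⟩
  ∑₂ (λ u v → inside u v + entering u v)        ≡⟨ ∑₂-distrib-+ inside entering ⟩
  ∑₂ inside + ∑₂ entering                       ∎)
  where
  open ≡-Reasoning
  inside leaving entering : Fin n → Fin n → ℕ
  inside   u v = 𝟙 (A u v ∧ (U u ∧ U v))
  leaving  u v = 𝟙 (A u v ∧ (U u ∧ not (U v)))
  entering u v = 𝟙 (A u v ∧ (not (U u) ∧ U v))

record Ranking (n : ℕ) : Set where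
  field
    rank           : Fin n → ℕ
    rank<n         : ∀ v → rank v < n
    rank-injective : Injective _≡_ _≡_ rank
open Ranking

backArcs : ∀ {n} → Arcs n → Ranking n → ℕ
backArcs A R = ∑₂ (λ u v → 𝟙 (A u v ∧ (rank R v <ᵇ rank R u)))

-- At most rank(v) in-arcs of v can come from lower ranks (count-below); for a
-- loopless relation all other in-arcs of v are backward arcs.
indeg∸rank≤backArcs : ∀ {n} {A : Arcs n} → Loopless A → (R : Ranking n) →
  ∑[ v < n ] (indeg A v ∸ rank R v) ≤ backArcs A R
indeg∸rank≤backArcs {n} {A} loopless R = begin
  ∑[ v < n ] (indeg A v ∸ rank R v)   ≤⟨ ∑-mono-≤ (λ v → m≤n+o⇒m∸n≤o (indeg A v) (rank R v) (indeg≤ v)) ⟩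
  ∑[ v < n ] ∑[ u < n ] back u v      ≡⟨ ∑-comm (λ v u → back u v) ⟩
  backArcs A R                         ∎
  where
  open ≤-Reasoning
  back : Fin n → Fin n → ℕ
  back u v = 𝟙 (A u v ∧ (rank R v <ᵇ rank R u))
  from-below-or-back : ∀ u v → 𝟙 (A u v) ≤ 𝟙 (rank R u <ᵇ rank R v) + back u v
  from-below-or-back u v with A u v in arc
  ... | false = z≤n
  ... | true with rank R u <ᵇ rank R v | <ᵇ-reflects-< (rank R u) (rank R v)
                | rank R v <ᵇ rank R u | <ᵇ-reflects-< (rank R v) (rank R u)
  ...   | true  | _     | _     | _     = s≤s z≤n
  ...   | false | _     | true  | _     = ≤-refl
  ...   | false | ofⁿ u≮v | false | ofⁿ v≮u
    with refl ← rank-injective R (≤-antisym (≮⇒≥ v≮u) (≮⇒≥ u≮v)) =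
      contradiction (trans (sym arc) (loopless u)) λ ()
  indeg≤ : ∀ v → indeg A v ≤ rank R v + ∑[ u < n ] back u v
  indeg≤ v = begin
    indeg A v                                                    ≤⟨ ∑-mono-≤ (λ u → from-below-or-back u v) ⟩
    ∑[ u < n ] (𝟙 (rank R u <ᵇ rank R v) + back u v)             ≡⟨ ∑-distrib-+ (λ u → 𝟙 (rank R u <ᵇ rank R v)) (λ u → back u v) ⟩
    ∑[ u < n ] 𝟙 (rank R u <ᵇ rank R v) + ∑[ u < n ] back u v   ≤⟨ +-monoˡ-≤ _ (count-below (rank R) (rank-injective R) (rank R v)) ⟩
    rank R v + ∑[ u < n ] back u v                               ∎

rotateRanking : ∀ {n} t → t ≤ n → Ranking n → Ranking n
rotateRanking {n} t t≤n R = record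
  { rank           = λ v → rotate n t (rank R v)
  ; rank<n         = λ v → rotate-< t≤n (rank<n R v)
  ; rank-injective = λ {u} {v} eq → rank-injective R (rotate-injective (rank<n R u) (rank<n R v) eq)
  }

-- In a balanced relation, rotating a ranking does not change the number of backward
-- arcs: by rotate-order the arcs that start being backward are those entering the set W
-- of vertices whose rank wraps around, those that stop being backward leave W, and
-- balanced-cut (applied to the complement of W) equates the two.
backArcs-rotate : ∀ {n} {A : Arcs n} → Balanced A → (R : Ranking n) → ∀ t (t≤n : t ≤ n) →
  backArcs A (rotateRanking t t≤n R) ≡ backArcs A R
backArcs-rotate {n} {A} balanced R t t≤n = +-cancelʳ-≡ (∑₂ enter-W) (backArcs A R′) (backArcs A R) (begin
  backArcs A R′ + ∑₂ enter-W            ≡⟨ cong (backArcs A R′ +_) (balanced-cut balanced unwrapped) ⟩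
  backArcs A R′ + ∑₂ leave-W            ≡⟨ ∑₂-distrib-+ back′ leave-W ⟨
  ∑₂ (λ u v → back′ u v + leave-W u v)  ≡⟨ ∑₂-cong (λ u v → 𝟙-∧-cong (A u v) (rotate-order (rank<n R u) (rank<n R v))) ⟩
  ∑₂ (λ u v → back u v + enter-W u v)   ≡⟨ ∑₂-distrib-+ back enter-W ⟩
  backArcs A R + ∑₂ enter-W             ∎)
  where
  open ≡-Reasoning
  R′ = rotateRanking t t≤n R
  unwrapped : Fin n → Bool
  unwrapped v = rank R v + t <ᵇ n
  back back′ enter-W leave-W : Fin n → Fin n → ℕ
  back    u v = 𝟙 (A u v ∧ (rank R v <ᵇ rank R u))
  back′   u v = 𝟙 (A u v ∧ (rank R′ v <ᵇ rank R′ u))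
  enter-W u v = 𝟙 (A u v ∧ (unwrapped u ∧ not (unwrapped v)))
  leave-W u v = 𝟙 (A u v ∧ (not (unwrapped u) ∧ unwrapped v))
  𝟙-∧-cong : ∀ a {b c b′ c′} → 𝟙 b + 𝟙 c ≡ 𝟙 b′ + 𝟙 c′ → 𝟙 (a ∧ b) + 𝟙 (a ∧ c) ≡ 𝟙 (a ∧ b′) + 𝟙 (a ∧ c′)
  𝟙-∧-cong true  eq = eq
  𝟙-∧-cong false eq = refl

indeg≤n : ∀ {n} (A : Arcs n) v → indeg A v ≤ n
indeg≤n {n} A v = ≤-trans (∑-bounded 1 (λ u → 𝟙≤1 (A u v))) (≤-reflexive (*-identityʳ n))

-- Key estimate: summing indeg∸rank≤backArcs over the n rotations of R, every vertex
-- of in-degree d takes every rank 0, …, n-1 once and contributes at least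
-- ∑_k (d - k) = d(d+1)/2, while every rotation has exactly backArcs A R backward arcs.
rotation-estimate : ∀ {n} {A : Arcs n} → Balanced A → Loopless A → (R : Ranking n) →
  ∑[ v < n ] (indeg A v * suc (indeg A v)) ≤ 2 * (n * backArcs A R)
rotation-estimate {n} {A} balanced loopless R = begin
  ∑[ v < n ] (d v * suc (d v))                                  ≤⟨ ∑-mono-≤ (λ v → triangle-≤ (indeg≤n A v)) ⟩
  ∑[ v < n ] (2 * Σ< n (d v ∸_))                                ≡⟨ *-distribˡ-sum 2 (λ v → Σ< n (d v ∸_)) ⟨
  2 * ∑[ v < n ] Σ< n (d v ∸_)                                  ≡⟨ cong (2 *_) (sum-cong-≗ (λ v → rotation-sum (rank<n R v) (d v ∸_))) ⟨
  2 * ∑[ v < n ] Σ< n (λ t → d v ∸ rotate n t (rank R v))       ≡⟨ cong (2 *_) (∑-comm {n} {n} (λ v i → d v ∸ rotate n (toℕ i) (rank R v))) ⟩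
  2 * Σ< n (λ t → ∑[ v < n ] (d v ∸ rotate n t (rank R v)))     ≤⟨ *-monoʳ-≤ 2 (∑-mono-≤ rotated-bound) ⟩
  2 * ∑[ i < n ] backArcs A R                                   ≡⟨ cong (2 *_) (∑-const n (backArcs A R)) ⟩
  2 * (n * backArcs A R)                                        ∎
  where
  open ≤-Reasoning
  d : Fin n → ℕ
  d = indeg A
  rotated-bound : ∀ (i : Fin n) → ∑[ v < n ] (d v ∸ rotate n (toℕ i) (rank R v)) ≤ backArcs A R
  rotated-bound i = ≤-trans (indeg∸rank≤backArcs loopless (rotateRanking (toℕ i) t≤n R))
                            (≤-reflexive (backArcs-rotate balanced R (toℕ i) t≤n))
    where t≤n = <⇒≤ (toℕ<n i)

record SimplePath {n} (E : Arcs n) : Set where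
  field
    len      : ℕ
    vertex   : ℕ → Fin n
    distinct : ∀ {i j} → i ≤ len → j ≤ len → vertex i ≡ vertex j → i ≡ j
    step     : ∀ i → i < len → T (E (vertex i) (vertex (suc i)))

module _ {n} {E : Arcs n} (P : SimplePath E) where
  open SimplePath P

  path-short : len < n
  path-short = injective⇒≤ {f = vertex ∘ toℕ} λ {i} {j} eq →
    toℕ-injective (distinct (s≤s⁻¹ (toℕ<n i)) (s≤s⁻¹ (toℕ<n j)) eq)

  close-cycle : ∀ j → j ≤ len → T (E (vertex j) (vertex 0)) → DirectedCycle E
  close-cycle j j≤len back = record
    { k        = j
    ; c        = vertex ∘ toℕ
    ; distinct = λ {a} {b} eq → toℕ-injective (distinct (on-segment a) (on-segment b) eq)
    ; step     = λ i → subst (λ x → T (E (vertex x) (vertex (suc (toℕ i))))) (sym (toℕ-inject₁ i))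
                             (step (toℕ i) (<-≤-trans (toℕ<n i) j≤len))
    ; close    = subst (λ x → T (E (vertex x) (vertex 0))) (sym (toℕ-fromℕ j)) back
    }
    where
    on-segment : ∀ (a : Fin (suc j)) → toℕ a ≤ len
    on-segment a = ≤-trans (s≤s⁻¹ (toℕ<n a)) j≤len

  prepend : ∀ y → (∀ i → i ≤ len → vertex i ≢ y) → T (E y (vertex 0)) → SimplePath E
  prepend y fresh arc = record { len = suc len ; vertex = vertex′ ; distinct = distinct′ ; step = step′ }
    where
    vertex′ : ℕ → Fin n
    vertex′ zero    = y
    vertex′ (suc i) = vertex i
    distinct′ : ∀ {i j} → i ≤ suc len → j ≤ suc len → vertex′ i ≡ vertex′ j → i ≡ j
    distinct′ {zero}  {zero}  _  _  _  = refl
    distinct′ {zero}  {suc j} _  j≤ eq = contradiction (sym eq) (fresh j (s≤s⁻¹ j≤))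
    distinct′ {suc i} {zero}  i≤ _  eq = contradiction eq (fresh i (s≤s⁻¹ i≤))
    distinct′ {suc i} {suc j} i≤ j≤ eq = cong suc (distinct (s≤s⁻¹ i≤) (s≤s⁻¹ j≤) eq)
    step′ : ∀ i → i < suc len → T (E (vertex′ i) (vertex′ (suc i)))
    step′ zero    _   = arc
    step′ (suc i) i<  = step i (s≤s⁻¹ i<)

-- If every vertex has a predecessor, a simple path can be extended backwards until
-- the new predecessor is already on it, and then it closes into a directed cycle;
-- path-short bounds the number of extensions.
cycle-from-predecessors : ∀ {n} {E : Arcs n} → (∀ v → ∃[ u ] T (E u v)) → Fin n → DirectedCycle E
cycle-from-predecessors {n} {E} pred v = extend n trivial refl
  where
  trivial : SimplePath E
  trivial = record { len = 0 ; vertex = λ _ → v ; distinct = λ { z≤n z≤n _ → refl } ; step = λ _ () }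
  extend : ∀ fuel (P : SimplePath E) → SimplePath.len P + fuel ≡ n → DirectedCycle E
  extend zero P len+0≡n = contradiction (path-short P) (<-irrefl (trans (sym (+-identityʳ _)) len+0≡n))
  extend (suc fuel) P len+fuel≡n with pred (SimplePath.vertex P 0)
  ... | y , arc with any? (λ (i : Fin (suc (SimplePath.len P))) → SimplePath.vertex P (toℕ i) ≟ y)
  ...   | yes (i , on-path) = close-cycle P (toℕ i) (s≤s⁻¹ (toℕ<n i)) (subst (λ x → T (E x _)) (sym on-path) arc)
  ...   | no off-path = extend fuel (prepend P y fresh arc) (trans (sym (+-suc _ fuel)) len+fuel≡n)
    where
    fresh : ∀ i → i ≤ SimplePath.len P → SimplePath.vertex P i ≢ y
    fresh i i≤len eq = off-path (fromℕ< (s≤s i≤len) , trans (cong (SimplePath.vertex P) (toℕ-fromℕ< (s≤s i≤len))) eq)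

source : ∀ {n} {E : Arcs n} → Acyclic E → Fin n → ∃[ s ] (∀ u → ¬ T (E u s))
source {n} {E} acyclic v with any? (λ s → all? (λ u → ¬? (T? (E u s))))
... | yes found = found
... | no  none  = contradiction (cycle-from-predecessors has-predecessor v) acyclic
  where
  has-predecessor : ∀ w → ∃[ u ] T (E u w)
  has-predecessor w with ¬∀⟶∃¬ n _ (λ u → ¬? (T? (E u w))) (λ no-pred → none (w , no-pred))
  ... | u , ¬¬arc = u , decidable-stable (T? (E u w)) ¬¬arc

map-cycle : ∀ {m n} {E′ : Arcs m} {E : Arcs n} (f : Fin m → Fin n) → Injective _≡_ _≡_ f →
  (∀ u v → T (E′ u v) → T (E (f u) (f v))) → DirectedCycle E′ → DirectedCycle E
map-cycle f f-injective arcs C = record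
  { k = k ; c = f ∘ c ; distinct = distinct ∘ f-injective
  ; step = λ i → arcs _ _ (step i) ; close = arcs _ _ close }
  where open DirectedCycle C

-- Every acyclic relation has a ranking along which all its arcs point upwards:
-- give a source rank 0 and rank the remaining vertices recursively.
topological-sort : ∀ {n} (E : Arcs n) → Acyclic E →
  Σ (Ranking n) λ R → ∀ u v → T (E u v) → rank R u < rank R v
topological-sort {zero}  E acyclic = record { rank = λ () ; rank<n = λ () ; rank-injective = λ { {()} } } , λ ()
topological-sort {suc n} E acyclic = record { rank = r ; rank<n = r<n ; rank-injective = r-injective } , upward
  where
  src = source acyclic zero
  s = proj₁ src
  E′ : Arcs n
  E′ u v = E (punchIn s u) (punchIn s v)
  rest = topological-sort E′ (acyclic ∘ map-cycle (punchIn s) (punchIn-injective s _ _) (λ _ _ arc → arc))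
  R′ = proj₁ rest
  upward′ = proj₂ rest
  r : Fin (suc n) → ℕ
  r v with s ≟ v
  ... | yes _   = 0
  ... | no  s≢v = suc (rank R′ (punchOut s≢v))
  r<n : ∀ v → r v < suc n
  r<n v with s ≟ v
  ... | yes _   = s≤s z≤n
  ... | no  s≢v = s≤s (rank<n R′ (punchOut s≢v))
  r-injective : Injective _≡_ _≡_ r
  -- (the mixed cases would equate 0 with a successor)
  r-injective {u} {v} eq with s ≟ u | s ≟ v
  ... | yes refl | yes refl = refl
  ... | no  s≢u  | no  s≢v  = punchOut-injective s≢u s≢v (rank-injective R′ (suc-injective eq))
  upward : ∀ u v → T (E u v) → r u < r v
  upward u v arc with s ≟ u | s ≟ v
  ... | _        | yes refl = contradiction arc (proj₂ src u)
  ... | yes refl | no  _    = s≤s z≤n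
  ... | no  s≢u  | no  s≢v  = s≤s (upward′ _ _
        (subst₂ (λ a b → T (E a b)) (sym (punchIn-punchOut s≢u)) (sym (punchIn-punchOut s≢v)) arc))

square-sum-bound : ∀ n (d : Fin n → ℕ) →
  ∑[ v < n ] d v * ∑[ v < n ] d v + ∑[ v < n ] d v * n ≤ n * ∑[ v < n ] (d v * suc (d v))
square-sum-bound n d = begin
  m * m + m * n                          ≤⟨ +-monoˡ-≤ (m * n) (cauchy-schwarz n d) ⟩
  n * ∑[ v < n ] (d v * d v) + m * n     ≡⟨ cong (n * ∑[ v < n ] (d v * d v) +_) (*-comm m n) ⟩
  n * ∑[ v < n ] (d v * d v) + n * m     ≡⟨ *-distribˡ-+ n _ m ⟨
  n * (∑[ v < n ] (d v * d v) + m)       ≡⟨ cong (n *_) (∑-distrib-+ (λ v → d v * d v) d) ⟨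
  n * ∑[ v < n ] (d v * d v + d v)       ≡⟨ cong (n *_) (sum-cong-≗ (λ v → trans (+-comm (d v * d v) (d v)) (sym (*-suc (d v) (d v))))) ⟩
  n * ∑[ v < n ] (d v * suc (d v))       ∎
  where
  open ≤-Reasoning
  m = ∑[ v < n ] d v

backArcs≤feedback : ∀ {n} (G : Digraph n) (F : Fin n → Fin n → Bool) (R : Ranking n) →
  (∀ u v → T (arc G u v ∧ not (F u v)) → rank R u < rank R v) → backArcs (arc G) R ≤ count₂ F
backArcs≤feedback {n} G F R upward =
  ≤-trans (∑-mono-≤ λ u → ∑-mono-≤ λ v → backward⇒in-F u v) (≤-reflexive (sym (count₂≡∑ F)))
  where
  backward⇒in-F : ∀ u v → 𝟙 (arc G u v ∧ (rank R v <ᵇ rank R u)) ≤ 𝟙 (F u v)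
  backward⇒in-F u v with arc G u v in a | F u v in f
  ... | false | _     = z≤n
  ... | true  | true  = 𝟙≤1 _
  ... | true  | false rewrite <ᵇ-false (<⇒≯ (upward u v (subst₂ (λ x y → T (x ∧ not y)) (sym a) (sym f) _))) = z≤n

numArcs≡∑indeg : ∀ {n} (G : Digraph n) → numArcs G ≡ ∑[ v < n ] indeg (arc G) v
numArcs≡∑indeg G = trans (count₂≡∑ (arc G)) (∑-comm (λ u v → 𝟙 (arc G u v)))

eulerian⇒balanced : ∀ {n} (G : Digraph n) → Eulerian G → Balanced (arc G)
eulerian⇒balanced G eulerian v = trans (sym (count≡∑ (λ u → arc G u v))) (trans (eulerian v) (count≡∑ (arc G v)))

theorem1p1 : ∀ (n : ℕ) (G : Digraph n) → Eulerian G →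
    ∀ (F : Fin n → Fin n → Bool) → IsFeedbackArcSet G F →
    numArcs G * numArcs G + numArcs G * n ≤ 2 * (n * n) * count₂ F
theorem1p1 n G eulerian F (_ , acyclic) with topological-sort _ acyclic
... | R , upward = begin
  m * m + m * n                          ≡⟨ cong (λ x → x * x + x * n) (numArcs≡∑indeg G) ⟩
  ∑d * ∑d + ∑d * n                       ≤⟨ square-sum-bound n d ⟩
  n * ∑[ v < n ] (d v * suc (d v))       ≤⟨ *-monoʳ-≤ n (rotation-estimate (eulerian⇒balanced G eulerian) (noLoop G) R) ⟩
  n * (2 * (n * backArcs (arc G) R))     ≤⟨ *-monoʳ-≤ n (*-monoʳ-≤ 2 (*-monoʳ-≤ n (backArcs≤feedback G F R upward))) ⟩
  n * (2 * (n * count₂ F))               ≡⟨ solve 2 (λ n f → n :* (con 2 :* (n :* f)) := con 2 :* (n :* n) :* f) refl n (count₂ F) ⟩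
  2 * (n * n) * count₂ F                 ∎
  where
  open ≤-Reasoning
  open +-*-Solver
  m = numArcs G
  d = indeg (arc G)
  ∑d = ∑[ v < n ] d v
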